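{- For every path $P_n$ on $n\geq 2$ vertices, $\mathrm{th}_{\mathrm{H}}(P_n)=\lceil 2\sqrt{n-1}\rceil$.
   Context: All graphs are finite, simple and undirected; $N(v)$ is the open neighborhood of $v$. Vertices are colored blue or white. Under the hopping color change rule, a blue vertex $v$ may force a white vertex $w$ (not necessarily adjacent to $v$) to become blue provided $v$ has not previously performed a force and every vertex of $N(v)$ is blue. Starting from an initial blue set $B\subseteq V(G)$, a chronological list of forces is a sequence of valid forces performed one at a time until no further force is possible; its unordered set of forces is a set of forces of $B$. $B$ is a hopping forcing set if some chronological list turns every vertex blue. For a set of forces $\mathcal F$ of $B$, put $\mathcal F^{(0)}=B$ and, for $t>0$, let $\mathcal F^{(t)}$ be the set of vertices $w$ for which there is a force $v\to w$ in $\mathcal F$ with $v\in\bigcup_{i<t}\mathcal F^{(i)}$ that is a valid hopping force when exactly the vertices of $\bigcup_{i<t}\mathcal F^{(i)}$ are blue. $\mathrm{pt}_{\mathrm{H}}(G;\mathcal F)$ is the least $t$ with $\bigcup_{i\le t}\mathcal F^{(i)}=V(G)$, and $\mathrm{pt}_{\mathrm{H}}(G;B)$ is the minimum of $\mathrm{pt}_{\mathrm{H}}(G;\mathcal F)$ over sets of forces $\mathcal F$ of $B$ ($\infty$ if $B$ is not a hopping forcing set). The hopping throttling number is $\mathrm{th}_{\mathrm{H}}(G)=\min_{B\subseteq V(G)}\big(|B|+\mathrm{pt}_{\mathrm{H}}(G;B)\big)$. -}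

module Defs where

open import Data.Nat using (ℕ; zero; suc; _+_; _*_; _≤_)
open import Data.Fin using (Fin; toℕ)
open import Data.Fin.Subset using (Subset; _∈_; _∉_; _∪_; ⁅_⁆; ⊥; ∣_∣)
open import Data.List using (List; []; _∷_)
open import Data.List.Membership.Propositional using () renaming (_∈_ to _∈ₗ_)
open import Data.Product using (Σ; _×_; _,_; ∃)
open import Data.Sum using (_⊎_)
open import Relation.Nullary using (¬_)
open import Relation.Binary.PropositionalEquality using (_≡_)

Adjacency : ℕ → Set₁
Adjacency n = Fin n → Fin n → Set

pathAdj : (n : ℕ) → Adjacency n
pathAdj n i j = (toℕ j ≡ suc (toℕ i)) ⊎ (toℕ i ≡ suc (toℕ j))

-- A force is a pair (v , w) meaning v → w.
Force : ℕ → Set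
Force n = Fin n × Fin n

module _ {n : ℕ} (G : Adjacency n) where

  NbhdIn : (Fin n → Set) → Fin n → Set
  NbhdIn S v = ∀ u → G v u → S u

  -- v → w is a valid hopping force when S is the blue set and
  -- D is the set of vertices that have already performed a force.
  ValidForce : Subset n → Subset n → Fin n → Fin n → Set
  ValidForce S D v w = (v ∈ S) × (v ∉ D) × NbhdIn (λ u → u ∈ S) v × (w ∉ S)

  data ChronList : Subset n → Subset n → List (Force n) → Set where
    done : ∀ {S D} → (∀ v w → ¬ ValidForce S D v w) → ChronList S D []
    step : ∀ {S D v w L} → ValidForce S D v w →
           ChronList (S ∪ ⁅ w ⁆) (D ∪ ⁅ v ⁆) L →
           ChronList S D ((v , w) ∷ L)

  ChronListOf : Subset n → List (Force n) → Set
  ChronListOf B L = ChronList B ⊥ L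

  -- Cum B L t u : u ∈ ⋃_{i ≤ t} F^(i), where F is the set of forces in L.
  Cum : Subset n → List (Force n) → ℕ → Fin n → Set
  Cum B L zero u = u ∈ B
  Cum B L (suc t) u =
    Cum B L t u ⊎
    (∃ λ v → ((v , u) ∈ₗ L) × Cum B L t v × NbhdIn (Cum B L t) v)

  Covers : Subset n → List (Force n) → ℕ → Set
  Covers B L t = ∀ u → Cum B L t u

  ThH : ℕ → Set
  ThH k =
    (Σ (Subset n) λ B → Σ (List (Force n)) λ L → Σ ℕ λ t →
       ChronListOf B L × Covers B L t × (∣ B ∣ + t ≡ k)) ×
    (∀ (B : Subset n) (L : List (Force n)) (t : ℕ) →
       ChronListOf B L → Covers B L t → k ≤ ∣ B ∣ + t)

-- k = ⌈ 2 √m ⌉ for natural m, i.e. k is the least natural with 4m ≤ k².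
IsCeil2Sqrt : ℕ → ℕ → Set
IsCeil2Sqrt m k = (4 * m ≤ k * k) × (∀ j → 4 * m ≤ j * j → k ≤ j)

-- In a connected graph the forcers of one round are distinct blue vertices, and while some
-- vertex is still white, some blue vertex has a white neighbour and cannot force. So a round
-- adds at most |B| − 1 blue vertices, n ≤ |B| + t(|B| − 1), and AM–GM gives
-- 4(n − 1) ≤ (|B| + t)². Conversely, colour the first ⌊k/2⌋ + 1 vertices of the path and let
-- vertex j force vertex j + |B|, in order: each round turns ⌊k/2⌋ more vertices blue, and
-- ⌈k/2⌉ − 1 rounds suffice because 4(n − 1) ≤ k² ≤ 4⌊k/2⌋⌈k/2⌉ + 1.
module Submission where

open import Defs
open import Data.Nat using (ℕ; zero; suc; pred; _+_; _*_; _∸_; _≤_; _<_; z≤n; s≤s; ⌊_/2⌋; ⌈_/2⌉)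
open import Data.Nat.Properties
open import Data.Nat.Solver using (module +-*-Solver)
open import Data.Fin using (Fin; zero; suc; toℕ)
open import Data.Fin.Properties
  using (any?; all?; ¬∀⟶∃¬; toℕ-injective; toℕ<n; toℕ≤pred[n]) renaming (_≟_ to _≟ᶠ_)
open import Data.Fin.Subset using (Subset; _∈_; _∉_; _∪_; ⁅_⁆; ∣_∣; _-_; ⊥; ⊤; inside; outside)
open import Data.Fin.Subset.Properties
  using (_∈?_; x∈p∪q⁺; x∈p∪q⁻; x∈⁅x⁆; x∈⁅y⁆⇒x≡y; ∉⊥; Empty-unique;
         ∣⁅x⁆∣≡1; ∣⊤∣≡n; ∣⊥∣≡0; p⊆q⇒∣p∣≤∣q∣; x∈p⇒∣p-x∣<∣p∣; x∈p∧x≢y⇒x∈p-y)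
open import Data.Bool using (true)
open import Data.Vec using ([]; _∷_; tabulate; here; there)
open import Data.Vec.Properties using (lookup∘tabulate; lookup⇒[]=; []=⇒lookup)
open import Data.List using (List; []; _∷_; length; map; filter)
open import Data.List.Properties using (length-map)
open import Data.List.Membership.Propositional.Properties using (∈-map⁺; ∈-filter⁺)
open import Data.List.Membership.Propositional using () renaming (_∈_ to _∈ₗ_)
open import Data.List.Relation.Unary.Any using () renaming (here to hereₗ; there to thereₗ)
open import Data.List.Relation.Unary.All as All using (All; []; _∷_)
open import Data.List.Relation.Unary.AllPairs using (AllPairs; []; _∷_)
import Data.List.Relation.Unary.All.Properties as All
import Data.List.Relation.Unary.AllPairs.Properties as AllPairs
open import Data.List.Relation.Unary.Unique.Propositional using (Unique)
open import Data.Product using (Σ; _×_; _,_; ∃; ∃₂; proj₁; proj₂)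
open import Data.Product.Properties using (≡-dec)
open import Data.Sum using (_⊎_; inj₁; inj₂; [_,_]; [_,_]′; map₂)
open import Function using (id; _∘_)
open import Relation.Nullary using (¬_; ¬?; Dec; yes; no; does; contradiction)
open import Relation.Nullary.Decidable using (dec-true; decidable-stable; _×-dec_; _⊎-dec_; _→-dec_)
open import Relation.Unary using (Decidable)
open import Relation.Binary.PropositionalEquality
  using (_≡_; _≢_; refl; sym; trans; cong; subst; subst₂; ≢-sym)

∣p∪q∣≤∣p∣+∣q∣ : ∀ {n} (p q : Subset n) → ∣ p ∪ q ∣ ≤ ∣ p ∣ + ∣ q ∣
∣p∪q∣≤∣p∣+∣q∣ []            []            = z≤n
∣p∪q∣≤∣p∣+∣q∣ (outside ∷ p) (outside ∷ q) = ∣p∪q∣≤∣p∣+∣q∣ p q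
∣p∪q∣≤∣p∣+∣q∣ (outside ∷ p) (inside  ∷ q) =
  ≤-trans (s≤s (∣p∪q∣≤∣p∣+∣q∣ p q)) (≤-reflexive (sym (+-suc ∣ p ∣ ∣ q ∣)))
∣p∪q∣≤∣p∣+∣q∣ (inside  ∷ p) (outside ∷ q) = s≤s (∣p∪q∣≤∣p∣+∣q∣ p q)
∣p∪q∣≤∣p∣+∣q∣ (inside  ∷ p) (inside  ∷ q) =
  s≤s (≤-trans (∣p∪q∣≤∣p∣+∣q∣ p q) (+-monoʳ-≤ ∣ p ∣ (n≤1+n ∣ q ∣)))

∣p∣≤∣q∣+length : ∀ {n} {p q : Subset n} (xs : List (Fin n)) →
                 (∀ {x} → x ∈ p → x ∈ q ⊎ x ∈ₗ xs) → ∣ p ∣ ≤ ∣ q ∣ + length xs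
∣p∣≤∣q∣+length {p = p} {q} [] p⊆q∪[] =
  ≤-trans (p⊆q⇒∣p∣≤∣q∣ {p = p} {q} (λ x∈p → [ id , (λ ()) ] (p⊆q∪[] x∈p))) (m≤m+n ∣ q ∣ 0)
∣p∣≤∣q∣+length {p = p} {q} (y ∷ xs) p⊆q∪y∷xs = begin
  ∣ p ∣                          ≤⟨ ∣p∣≤∣q∣+length xs p⊆q∪y∪xs ⟩
  ∣ q ∪ ⁅ y ⁆ ∣ + length xs      ≤⟨ +-monoˡ-≤ (length xs) (∣p∪q∣≤∣p∣+∣q∣ q ⁅ y ⁆) ⟩
  ∣ q ∣ + ∣ ⁅ y ⁆ ∣ + length xs  ≡⟨ cong (λ m → ∣ q ∣ + m + length xs) (∣⁅x⁆∣≡1 y) ⟩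
  ∣ q ∣ + 1 + length xs          ≡⟨ +-assoc ∣ q ∣ 1 (length xs) ⟩
  ∣ q ∣ + length (y ∷ xs)        ∎
  where
  open ≤-Reasoning
  p⊆q∪y∪xs : ∀ {x} → x ∈ p → x ∈ q ∪ ⁅ y ⁆ ⊎ x ∈ₗ xs
  p⊆q∪y∪xs x∈p with p⊆q∪y∷xs x∈p
  ... | inj₁ x∈q          = inj₁ (x∈p∪q⁺ (inj₁ x∈q))
  ... | inj₂ (hereₗ refl)  = inj₁ (x∈p∪q⁺ (inj₂ (x∈⁅x⁆ y)))
  ... | inj₂ (thereₗ x∈xs) = inj₂ x∈xs

length≤∣p∣ : ∀ {n} {p : Subset n} {xs : List (Fin n)} →
             Unique xs → All (_∈ p) xs → length xs ≤ ∣ p ∣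
length≤∣p∣ [] [] = z≤n
length≤∣p∣ {p = p} {x ∷ xs} (x∉xs ∷ xs!) (x∈p ∷ xs⊆p) = begin-strict
  length xs  ≤⟨ length≤∣p∣ xs! xs⊆p-x ⟩
  ∣ p - x ∣  <⟨ x∈p⇒∣p-x∣<∣p∣ x∈p ⟩
  ∣ p ∣      ∎
  where
  open ≤-Reasoning
  xs⊆p-x : All (_∈ p - x) xs
  xs⊆p-x = All.zipWith (λ (x≢y , y∈p) → x∈p∧x≢y⇒x∈p-y y∈p (≢-sym x≢y)) (x∉xs , xs⊆p)

n≤∣p∣ : ∀ {n} {p : Subset n} → (∀ x → x ∈ p) → n ≤ ∣ p ∣
n≤∣p∣ {n} {p} all∈p = subst (_≤ ∣ p ∣) (∣⊤∣≡n n) (p⊆q⇒∣p∣≤∣q∣ {p = ⊤} (λ {x} _ → all∈p x))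

module _ {n : ℕ} {P : Fin n → Set} (P? : Decidable P) where

  toSubset : Subset n
  toSubset = tabulate (does ∘ P?)

  ∈toSubset⁺ : ∀ {i} → P i → i ∈ toSubset
  ∈toSubset⁺ {i} Pi = lookup⇒[]= i _ (trans (lookup∘tabulate _ i) (dec-true (P? i) Pi))

  ∈toSubset⁻ : ∀ {i} → i ∈ toSubset → P i
  ∈toSubset⁻ {i} i∈ = witness (P? i) (trans (sym (lookup∘tabulate _ i)) ([]=⇒lookup i∈))
    where
    witness : ∀ {A : Set} (a? : Dec A) → does a? ≡ true → A
    witness (yes a) _ = a

module _ where
  open +-*-Solver

  4*m*n≤[m+n]² : ∀ m n → 4 * (m * n) ≤ (m + n) * (m + n)
  4*m*n≤[m+n]² m n = [ ordered , swapped ]′ (≤-total m n)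
    where
    square-split : ∀ m d → (m + (m + d)) * (m + (m + d)) ≡ 4 * (m * (m + d)) + d * d
    square-split = solve 2 (λ m d → (m :+ (m :+ d)) :* (m :+ (m :+ d))
                                  := con 4 :* (m :* (m :+ d)) :+ d :* d) refl
    ordered : ∀ {m n} → m ≤ n → 4 * (m * n) ≤ (m + n) * (m + n)
    ordered {m} m≤n with d , refl ← m≤n⇒∃[o]m+o≡n m≤n =
      ≤-trans (m≤m+n _ (d * d)) (≤-reflexive (sym (square-split m d)))
    swapped : n ≤ m → 4 * (m * n) ≤ (m + n) * (m + n)
    swapped n≤m =
      subst₂ _≤_ (cong (4 *_) (*-comm n m)) (cong (λ s → s * s) (+-comm n m)) (ordered n≤m)

  [k]²≤1+4*⌊k/2⌋*⌈k/2⌉ : ∀ k → k * k ≤ suc (4 * (⌊ k /2⌋ * ⌈ k /2⌉))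
  [k]²≤1+4*⌊k/2⌋*⌈k/2⌉ zero = z≤n
  [k]²≤1+4*⌊k/2⌋*⌈k/2⌉ (suc zero) = s≤s z≤n
  [k]²≤1+4*⌊k/2⌋*⌈k/2⌉ (suc (suc k)) = begin
    (2 + k) * (2 + k)                       ≡⟨ expand-left k ⟩
    k * k + (4 * k + 4)                     ≤⟨ +-monoˡ-≤ (4 * k + 4) ([k]²≤1+4*⌊k/2⌋*⌈k/2⌉ k) ⟩
    suc (4 * (a * c)) + (4 * k + 4)         ≡⟨ cong (λ m → suc (4 * (a * c)) + (4 * m + 4))
                                                       (sym (⌊n/2⌋+⌈n/2⌉≡n k)) ⟩
    suc (4 * (a * c)) + (4 * (a + c) + 4)   ≡⟨ cong suc (expand-right a c) ⟩
    suc (4 * (suc a * suc c))               ∎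
    where
    open ≤-Reasoning
    a c : ℕ
    a = ⌊ k /2⌋
    c = ⌈ k /2⌉
    expand-left : ∀ k → (2 + k) * (2 + k) ≡ k * k + (4 * k + 4)
    expand-left = solve 1 (λ k → (con 2 :+ k) :* (con 2 :+ k)
                                 := k :* k :+ (con 4 :* k :+ con 4)) refl
    expand-right : ∀ a c → 4 * (a * c) + (4 * (a + c) + 4) ≡ 4 * (suc a * suc c)
    expand-right = solve 2 (λ a c → con 4 :* (a :* c) :+ (con 4 :* (a :+ c) :+ con 4)
                                  := con 4 :* ((con 1 :+ a) :* (con 1 :+ c))) refl

4*m≤1+4*n⇒m≤n : ∀ {m n} → 4 * m ≤ suc (4 * n) → m ≤ n
4*m≤1+4*n⇒m≤n {m} {n} 4m≤1+4n with ≤-<-connex m n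
... | inj₁ m≤n = m≤n
... | inj₂ n<m = contradiction 4m≤1+4n λ 4m≤1+4n → m+n≮n 2 (4 * n)
  (≤-pred (≤-trans (≤-reflexive (sym (*-suc 4 n))) (≤-trans (*-monoʳ-≤ 4 n<m) 4m≤1+4n)))

4*[n∸1]≤n² : ∀ n → 4 * (n ∸ 1) ≤ n * n
4*[n∸1]≤n² zero = z≤n
4*[n∸1]≤n² (suc n) = subst (λ m → 4 * m ≤ suc n * suc n) (*-identityˡ n) (4*m*n≤[m+n]² 1 n)

4≤4*[n∸1] : ∀ {n} → 2 ≤ n → 4 ≤ 4 * (n ∸ 1)
4≤4*[n∸1] 2≤n = *-monoʳ-≤ 4 (∸-monoˡ-≤ 1 2≤n)

ceil2Sqrt-halves : ∀ {n k} → 2 ≤ n → IsCeil2Sqrt (n ∸ 1) k →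
  ∃₂ λ x t → 1 ≤ x × suc x ≤ n × n ∸ 1 ≤ x * suc t × suc x + t ≡ k
ceil2Sqrt-halves {k = zero} 2≤n (4m≤k² , _) = contradiction (≤-trans (4≤4*[n∸1] 2≤n) 4m≤k²) λ ()
ceil2Sqrt-halves {k = suc zero} 2≤n (4m≤k² , _) =
  contradiction (≤-trans (4≤4*[n∸1] 2≤n) 4m≤k²) λ { (s≤s ()) }
ceil2Sqrt-halves {n} {suc (suc k)} 2≤n (4m≤k² , least) =
  suc ⌊ k /2⌋ , ⌈ k /2⌉ , s≤s z≤n ,
  ≤-trans (s≤s (s≤s (⌊n/2⌋≤n k))) (least n (4*[n∸1]≤n² n)) ,
  4*m≤1+4*n⇒m≤n (≤-trans 4m≤k² ([k]²≤1+4*⌊k/2⌋*⌈k/2⌉ (suc (suc k)))) ,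
  cong (2 +_) (⌊n/2⌋+⌈n/2⌉≡n k)

4*[n∸1]≤[b+t]² : ∀ {n} b t → 2 ≤ n → n ≤ b + t * pred b → 4 * (n ∸ 1) ≤ (b + t) * (b + t)
4*[n∸1]≤[b+t]² zero t 2≤n n≤t*0 =
  contradiction (≤-trans 2≤n (≤-trans n≤t*0 (≤-reflexive (*-zeroʳ t)))) λ ()
4*[n∸1]≤[b+t]² {n} (suc x) t _ n≤b+t*x = begin
  4 * (n ∸ 1)                ≤⟨ *-monoʳ-≤ 4 (∸-monoˡ-≤ 1 n≤b+t*x) ⟩
  4 * (suc t * x)            ≤⟨ 4*m*n≤[m+n]² (suc t) x ⟩
  (suc t + x) * (suc t + x)  ≡⟨ cong (λ s → suc s * suc s) (+-comm t x) ⟩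
  (suc x + t) * (suc x + t)  ∎
  where open ≤-Reasoning

pred[m+n]≤pred[m]+n : ∀ m n → pred (m + n) ≤ pred m + n
pred[m+n]≤pred[m]+n zero    n = pred[n]≤n
pred[m+n]≤pred[m]+n (suc m) n = ≤-refl

-- Connectivity, phrased constructively: every decidable vertex set that is neither
-- empty nor everything has an edge leaving it.
Connected : ∀ {n} → Adjacency n → Set₁
Connected {n} G = ∀ {S : Fin n → Set} → Decidable S → ∀ {a c} → S a → ¬ S c →
                  ∃₂ λ z w → S z × G z w × ¬ S w

module _ {n : ℕ} {G : Adjacency n} where

  forcers∉ : ∀ {S D L} → ChronList G S D L → All ((_∉ D) ∘ proj₁) L
  forcers∉ (done _)                     = []
  forcers∉ (step (_ , v∉D , _ , _) rest) =
    v∉D ∷ All.map (λ u∉D∪v u∈D → u∉D∪v (x∈p∪q⁺ (inj₁ u∈D))) (forcers∉ rest)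

  forcers-distinct : ∀ {S D L} → ChronList G S D L → AllPairs (λ f g → proj₁ f ≢ proj₁ g) L
  forcers-distinct (done _)              = []
  forcers-distinct (step {v = v} _ rest) =
    All.map (λ u∉D∪v v≡u → u∉D∪v (x∈p∪q⁺ (inj₂ (subst (_∈ ⁅ v ⁆) v≡u (x∈⁅x⁆ v)))))
            (forcers∉ rest)
    ∷ forcers-distinct rest

module HoppingLowerBound {n : ℕ} (G : Adjacency n) (adj? : ∀ v → Decidable (G v))
                         (connected : Connected G)
                         (B : Subset n) (L : List (Force n)) (chron : ChronListOf G B L) where

  open import Data.List.Membership.DecPropositional (≡-dec (_≟ᶠ_ {n}) (_≟ᶠ_ {n}))
    using () renaming (_∈?_ to _∈ₗ?_)

  Blue : ℕ → Fin n → Set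
  Blue = Cum G B L

  CanForce : ℕ → Fin n → Set
  CanForce s v = Blue s v × NbhdIn G (Blue s) v

  blue? : ∀ s → Decidable (Blue s)
  nbhdBlue? : ∀ s → Decidable (NbhdIn G (Blue s))
  blue? zero    u = u ∈? B
  blue? (suc s) u =
    blue? s u ⊎-dec any? (λ v → ((v , u) ∈ₗ? L) ×-dec blue? s v ×-dec nbhdBlue? s v)
  nbhdBlue? s v = all? (λ u → adj? v u →-dec blue? s u)

  canForce? : ∀ s → Decidable (CanForce s)
  canForce? s v = blue? s v ×-dec nbhdBlue? s v

  blueSet : ℕ → Subset n
  blueSet s = toSubset (blue? s)

  forcesAt : ℕ → List (Force n)
  forcesAt s = filter (canForce? s ∘ proj₁) L

  forcersAt : ℕ → List (Fin n)
  forcersAt s = map proj₁ (forcesAt s)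

  blue-suc⇒ : ∀ s {u} → Blue (suc s) u → u ∈ B ⊎ ∃ λ v → (v , u) ∈ₗ L × CanForce s v
  blue-suc⇒ s       (inj₂ forced) = inj₂ forced
  blue-suc⇒ zero    (inj₁ u∈B)    = inj₁ u∈B
  blue-suc⇒ (suc s) (inj₁ blue) with blue-suc⇒ s blue
  ... | inj₁ u∈B = inj₁ u∈B
  ... | inj₂ (v , v→u , v-blue , N[v]-blue) =
    inj₂ (v , v→u , inj₁ v-blue , λ w v~w → inj₁ (N[v]-blue w v~w))

  ∣blue-suc∣≤∣B∣+#forces : ∀ s → ∣ blueSet (suc s) ∣ ≤ ∣ B ∣ + length (forcesAt s)
  ∣blue-suc∣≤∣B∣+#forces s =
    subst (λ m → ∣ blueSet (suc s) ∣ ≤ ∣ B ∣ + m) (length-map proj₂ (forcesAt s))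
      (∣p∣≤∣q∣+length (map proj₂ (forcesAt s))
        (λ u∈ → map₂ target (blue-suc⇒ s (∈toSubset⁻ (blue? (suc s)) u∈))))
    where
    target : ∀ {u} → ∃ (λ v → (v , u) ∈ₗ L × CanForce s v) → u ∈ₗ map proj₂ (forcesAt s)
    target (_ , v→u , canForce) = ∈-map⁺ proj₂ (∈-filter⁺ (canForce? s ∘ proj₁) v→u canForce)

  forcersAt-unique : ∀ s → Unique (forcersAt s)
  forcersAt-unique s =
    AllPairs.map⁺ (AllPairs.filter⁺ (canForce? s ∘ proj₁) (forcers-distinct chron))

  forcersAt-canForce : ∀ s → All (CanForce s) (forcersAt s)
  forcersAt-canForce s = All.map⁺ (All.all-filter (canForce? s ∘ proj₁) L)

  #forces≤pred∣blue∣ : ∀ s {c} → ¬ Blue s c → length (forcesAt s) ≤ pred ∣ blueSet s ∣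
  #forces≤pred∣blue∣ s ¬blue-c =
    subst (_≤ pred ∣ blueSet s ∣) (length-map proj₁ (forcesAt s)) bound-forcers
    where
    forcers-blue : All (_∈ blueSet s) (forcersAt s)
    forcers-blue = All.map (∈toSubset⁺ (blue? s) ∘ proj₁) (forcersAt-canForce s)
    bound-forcers : length (forcersAt s) ≤ pred ∣ blueSet s ∣
    bound-forcers with any? (blue? s)
    ... | yes (_ , blue-a) with z , w , blue-z , z~w , ¬blue-w ← connected (blue? s) blue-a ¬blue-c =
      <⇒≤pred (length≤∣p∣ (z∉forcers ∷ forcersAt-unique s)
                          (∈toSubset⁺ (blue? s) blue-z ∷ forcers-blue))
      where
      z∉forcers : All (z ≢_) (forcersAt s)
      z∉forcers =
        All.map (λ { (_ , N[f]-blue) refl → ¬blue-w (N[f]-blue w z~w) }) (forcersAt-canForce s)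
    ... | no ¬∃blue = ≤-trans (length≤∣p∣ (forcersAt-unique s) forcers-blue)
                              (≤-reflexive (trans ∣blue∣≡0 (sym (cong pred ∣blue∣≡0))))
      where
      ∣blue∣≡0 : ∣ blueSet s ∣ ≡ 0
      ∣blue∣≡0 = trans (cong ∣_∣ (Empty-unique (λ (u , u∈) → ¬∃blue (u , ∈toSubset⁻ (blue? s) u∈))))
                       (∣⊥∣≡0 n)

  bound : ℕ → ℕ
  bound s = ∣ B ∣ + s * pred ∣ B ∣

  ∣blue∣≤bound : ∀ s {c} → ¬ Blue s c → ∣ blueSet s ∣ ≤ bound s
  ∣blue-suc∣≤bound : ∀ s {c} → ¬ Blue s c → ∣ blueSet (suc s) ∣ ≤ bound (suc s)

  ∣blue∣≤bound zero    _       = ≤-trans (p⊆q⇒∣p∣≤∣q∣ (∈toSubset⁻ (blue? zero))) (m≤m+n ∣ B ∣ 0)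
  ∣blue∣≤bound (suc s) ¬blue-c = ∣blue-suc∣≤bound s (¬blue-c ∘ inj₁)

  ∣blue-suc∣≤bound s ¬blue-c = begin
    ∣ blueSet (suc s) ∣          ≤⟨ ∣blue-suc∣≤∣B∣+#forces s ⟩
    ∣ B ∣ + length (forcesAt s)  ≤⟨ +-monoʳ-≤ ∣ B ∣ (#forces≤pred∣blue∣ s ¬blue-c) ⟩
    ∣ B ∣ + pred ∣ blueSet s ∣   ≤⟨ +-monoʳ-≤ ∣ B ∣ (pred-mono-≤ (∣blue∣≤bound s ¬blue-c)) ⟩
    ∣ B ∣ + pred (bound s)       ≤⟨ +-monoʳ-≤ ∣ B ∣ (pred[m+n]≤pred[m]+n ∣ B ∣ _) ⟩
    bound (suc s)                ∎
    where open ≤-Reasoning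

  covered⇒n≤bound : ∀ t → Covers G B L t → n ≤ bound t
  covered⇒n≤bound zero    covered = ≤-trans (n≤∣p∣ covered) (m≤m+n ∣ B ∣ 0)
  covered⇒n≤bound (suc s) covered with all? (blue? s)
  ... | yes covered′ =
    ≤-trans (covered⇒n≤bound s covered′) (+-monoʳ-≤ ∣ B ∣ (m≤n+m _ (pred ∣ B ∣)))
  ... | no ¬covered′ =
    ≤-trans (n≤∣p∣ (λ u → ∈toSubset⁺ (blue? (suc s)) (covered u)))
            (∣blue-suc∣≤bound s (proj₂ (¬∀⟶∃¬ n (Blue s) (blue? s) ¬covered′)))

pathAdj? : ∀ {n} (v : Fin n) → Decidable (pathAdj n v)
pathAdj? v u = (toℕ u ≟ suc (toℕ v)) ⊎-dec (toℕ v ≟ suc (toℕ u))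

crossing : ∀ {P : ℕ → Set} → Decidable P → ∀ {i k} → i ≤ k → P i → ¬ P k →
           ∃ λ j → j < k × P j × ¬ P (suc j)
crossing P? {k = zero}  z≤n   Pi ¬Pk = contradiction Pi ¬Pk
crossing P? {i} {suc k} i≤1+k Pi ¬P1+k with P? k
... | yes Pk = k , ≤-refl , Pk , ¬P1+k
... | no ¬Pk with m≤n⇒m<n∨m≡n i≤1+k
...   | inj₂ refl  = contradiction Pi ¬P1+k
...   | inj₁ i<1+k with j , j<k , Pj , ¬P1+j ← crossing P? (≤-pred i<1+k) Pi ¬Pk =
  j , m<n⇒m<1+n j<k , Pj , ¬P1+j

-- Arguments beyond the last vertex are clamped to it.
vertex : ∀ {n} → ℕ → Fin (suc n)
vertex         zero    = zero
vertex {zero}  (suc m) = zero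
vertex {suc n} (suc m) = suc (vertex m)

toℕ-vertex : ∀ {n m} → m ≤ n → toℕ (vertex {n} m) ≡ m
toℕ-vertex {m = zero}    _         = refl
toℕ-vertex {suc n} {suc m} (s≤s m≤n) = cong suc (toℕ-vertex m≤n)

vertex-toℕ : ∀ {n} (i : Fin (suc n)) → vertex (toℕ i) ≡ i
vertex-toℕ i = toℕ-injective (toℕ-vertex (toℕ≤pred[n] i))

toℕ-vertex-suc : ∀ {n j} → suc j ≤ n → toℕ (vertex {n} (suc j)) ≡ suc (toℕ (vertex {n} j))
toℕ-vertex-suc 1+j≤n =
  trans (toℕ-vertex 1+j≤n) (cong suc (sym (toℕ-vertex (≤-trans (n≤1+n _) 1+j≤n))))

pathConnected : ∀ n → Connected (pathAdj n)
pathConnected zero _ {a = ()}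
pathConnected (suc n) {S} S? {a} {c} Sa ¬Sc =
  crossing-edge (toℕ≤pred[n] a) (toℕ≤pred[n] c)
                (subst S (sym (vertex-toℕ a)) Sa) (¬Sc ∘ subst S (vertex-toℕ c))
  where
  crossing-edge : ∀ {i k} → i ≤ n → k ≤ n → S (vertex i) → ¬ S (vertex k) →
                  ∃₂ λ z w → S z × pathAdj (suc n) z w × ¬ S w
  crossing-edge {i} {k} i≤n k≤n Si ¬Sk with ≤-total i k
  ... | inj₁ i≤k with j , j<k , Sj , ¬S1+j ← crossing (S? ∘ vertex) i≤k Si ¬Sk =
    vertex j , vertex (suc j) , Sj , inj₁ (toℕ-vertex-suc (≤-trans j<k k≤n)) , ¬S1+j
  ... | inj₂ k≤i with j , j<i , ¬Sj , ¬¬S1+j ← crossing (¬? ∘ S? ∘ vertex) k≤i ¬Sk (λ ¬Si → ¬Si Si) =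
    vertex (suc j) , vertex j , decidable-stable (S? _) ¬¬S1+j ,
    inj₂ (toℕ-vertex-suc (≤-trans j<i i≤n)) , ¬Sj

Below : ∀ {m} → Subset m → ℕ → Set
Below S k = ∀ {u} → u ∈ S → toℕ u < k

IsInitialSegment : ∀ {m} → Subset m → ℕ → Set
IsInitialSegment S k = Below S k × (∀ {u} → toℕ u < k → u ∈ S)

Below-∪⁅⁆ : ∀ {m} {S : Subset m} {w k} → Below S k → toℕ w ≡ k → Below (S ∪ ⁅ w ⁆) (suc k)
Below-∪⁅⁆ {S = S} {w} S<k w≡k u∈ with x∈p∪q⁻ S ⁅ w ⁆ u∈
... | inj₁ u∈S = m<n⇒m<1+n (S<k u∈S)
... | inj₂ u∈w = ≤-reflexive (cong suc (trans (cong toℕ (x∈⁅y⁆⇒x≡y w u∈w)) w≡k))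

IsInitialSegment-∪⁅⁆ : ∀ {m} {S : Subset m} {w k} → IsInitialSegment S k → toℕ w ≡ k →
                       IsInitialSegment (S ∪ ⁅ w ⁆) (suc k)
IsInitialSegment-∪⁅⁆ {w = w} {k} (S<k , <k⊆S) w≡k = Below-∪⁅⁆ S<k w≡k , <1+k⊆S∪w
  where
  <1+k⊆S∪w : ∀ {u} → toℕ u < suc k → u ∈ _ ∪ ⁅ w ⁆
  <1+k⊆S∪w {u} u<1+k with m≤n⇒m<n∨m≡n (≤-pred u<1+k)
  ... | inj₁ u<k  = x∈p∪q⁺ (inj₁ (<k⊆S u<k))
  ... | inj₂ u≡k  = x∈p∪q⁺ (inj₂ (subst (_∈ ⁅ w ⁆) (toℕ-injective (trans w≡k (sym u≡k))) (x∈⁅x⁆ w)))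

prefix : ∀ m → ℕ → Subset m
prefix zero    _       = []
prefix (suc m) zero    = ⊥
prefix (suc m) (suc k) = inside ∷ prefix m k

prefix-isInitialSegment : ∀ m k → IsInitialSegment (prefix m k) k
prefix-isInitialSegment m k = below m k , contains m k
  where
  below : ∀ m k → Below (prefix m k) k
  below (suc m) zero    u∈⊥        = contradiction u∈⊥ ∉⊥
  below (suc m) (suc k) here       = s≤s z≤n
  below (suc m) (suc k) (there u∈) = s≤s (below m k u∈)
  contains : ∀ m k {u} → toℕ u < k → u ∈ prefix m k
  contains (suc m) (suc k) {zero}  _         = here
  contains (suc m) (suc k) {suc u} (s≤s u<k) = there (contains m k u<k)

∣prefix∣≡ : ∀ {m k} → k ≤ m → ∣ prefix m k ∣ ≡ k
∣prefix∣≡ {zero}  z≤n       = refl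
∣prefix∣≡ {suc m} z≤n       = ∣⊥∣≡0 (suc m)
∣prefix∣≡ {suc m} (s≤s k≤m) = cong suc (∣prefix∣≡ k≤m)

module ShiftStrategy (n′ x : ℕ) (1≤x : 1 ≤ x) (b≤n : suc x ≤ suc n′) where

  n b : ℕ
  n = suc n′
  b = suc x

  forces : ℕ → ℕ → List (Force n)
  forces j zero    = []
  forces j (suc r) = (vertex j , vertex (j + b)) ∷ forces (suc j) r

  B : Subset n
  B = prefix n b

  L : List (Force n)
  L = forces 0 (n ∸ b)

  toℕ-forcer : ∀ {j} → j + b < n → toℕ (vertex {n′} j) ≡ j
  toℕ-forcer {j} j+b<n = toℕ-vertex (≤-pred (≤-trans (s≤s (m≤m+n j b)) j+b<n))

  toℕ-target : ∀ {j} → j + b < n → toℕ (vertex {n′} (j + b)) ≡ j + b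
  toℕ-target j+b<n = toℕ-vertex (≤-pred j+b<n)

  force-valid : ∀ {j S D} → j + b < n → IsInitialSegment S (j + b) → Below D j →
                ValidForce (pathAdj n) S D (vertex j) (vertex (j + b))
  force-valid {j} {S} j+b<n (S<j+b , <j+b⊆S) D<j =
    <j+b⊆S v<j+b , (λ v∈D → <-irrefl v≡j (D<j v∈D)) , N[v]⊆S ,
    (λ w∈S → <-irrefl (toℕ-target j+b<n) (S<j+b w∈S))
    where
    v≡j : toℕ (vertex {n′} j) ≡ j
    v≡j = toℕ-forcer j+b<n
    v<j+b : toℕ (vertex {n′} j) < j + b
    v<j+b = subst (_< j + b) (sym v≡j) (m<m+n j (s≤s z≤n))
    1+v<j+b : suc (toℕ (vertex {n′} j)) < j + b
    1+v<j+b = subst (λ m → suc m < j + b) (sym v≡j)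
                    (subst (_≤ j + b) (+-comm j 2) (+-monoʳ-≤ j (s≤s 1≤x)))
    N[v]⊆S : NbhdIn (pathAdj n) (_∈ S) (vertex j)
    N[v]⊆S u (inj₁ u≡1+v) = <j+b⊆S (subst (_< j + b) (sym u≡1+v) 1+v<j+b)
    N[v]⊆S u (inj₂ v≡1+u) = <j+b⊆S (<-trans (≤-reflexive (sym v≡1+u)) v<j+b)

  chron : ∀ r j {S D} → j + b + r ≡ n → IsInitialSegment S (j + b) → Below D j →
          ChronList (pathAdj n) S D (forces j r)
  chron zero j e (_ , <j+b⊆S) _ =
    done λ _ w (_ , _ , _ , w∉S) → w∉S (<j+b⊆S (subst (toℕ w <_) n≡j+b (toℕ<n w)))
    where
    n≡j+b : n ≡ j + b
    n≡j+b = trans (sym e) (+-identityʳ (j + b))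
  chron (suc r) j e S-initial D<j =
    step (force-valid j+b<n S-initial D<j)
         (chron r (suc j) (trans (sym (+-suc (j + b) r)) e)
                (IsInitialSegment-∪⁅⁆ S-initial (toℕ-target j+b<n))
                (Below-∪⁅⁆ D<j (toℕ-forcer j+b<n)))
    where
    j+b<n : j + b < n
    j+b<n = ≤-trans (s≤s (m≤m+n (j + b) r)) (≤-reflexive (trans (sym (+-suc (j + b) r)) e))

  chronL : ChronListOf (pathAdj n) B L
  chronL = chron (n ∸ b) 0 (m+[n∸m]≡n b≤n) (prefix-isInitialSegment n b)
                 (λ u∈⊥ → contradiction u∈⊥ ∉⊥)

  ∈forces : ∀ r j {i} → j ≤ i → i < j + r → (vertex i , vertex (i + b)) ∈ₗ forces j r
  ∈forces zero    j {i} j≤i i<j+0 = contradiction (subst (i <_) (+-identityʳ j) i<j+0) (≤⇒≯ j≤i)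
  ∈forces (suc r) j {i} j≤i i<j+1+r with m≤n⇒m<n∨m≡n j≤i
  ... | inj₂ refl = hereₗ refl
  ... | inj₁ j<i  = thereₗ (∈forces r (suc j) j<i (subst (i <_) (+-suc j r) i<j+1+r))

  ∈L : ∀ {j} → j + b < n → (vertex j , vertex (j + b)) ∈ₗ L
  ∈L {j} j+b<n = ∈forces (n ∸ b) 0 z≤n (m+n≤o⇒m≤o∸n (suc j) j+b<n)

  blue-within : ∀ r {u} → toℕ u ≤ x + r * x → Cum (pathAdj n) B L r u
  blue-within zero {u} u≤x+0 =
    proj₂ (prefix-isInitialSegment n b) (s≤s (subst (toℕ u ≤_) (+-identityʳ x) u≤x+0))
  blue-within (suc r) {u} u≤x+[1+r]x with toℕ u ≤? x + r * x
  ... | yes u≤x+rx = inj₁ (blue-within r u≤x+rx)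
  ... | no  u≰x+rx = inj₂ (vertex j , subst (λ w → (vertex j , w) ∈ₗ L) v+b≡u (∈L j+b<n) ,
                           blue-within r (≤-trans (n≤1+n _) 1+v≤x+rx) , N[v]-blue)
    where
    j = toℕ u ∸ b
    j+b≡u : j + b ≡ toℕ u
    j+b≡u = m∸n+n≡m (≤-trans (s≤s (m≤m+n x (r * x))) (≰⇒> u≰x+rx))
    j+b<n : j + b < n
    j+b<n = subst (_< n) (sym j+b≡u) (toℕ<n u)
    v+b≡u : vertex (j + b) ≡ u
    v+b≡u = toℕ-injective (trans (toℕ-target j+b<n) j+b≡u)
    1+v≤x+rx : suc (toℕ (vertex {n′} j)) ≤ x + r * x
    1+v≤x+rx = subst (λ m → suc m ≤ x + r * x) (sym (toℕ-forcer j+b<n))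
                     (+-cancelʳ-≤ x (suc j) (x + r * x) 1+j+x≤x+rx+x)
      where
      open ≤-Reasoning
      1+j+x≤x+rx+x : suc j + x ≤ x + r * x + x
      1+j+x≤x+rx+x = begin
        suc j + x          ≡⟨ sym (+-suc j x) ⟩
        j + b              ≡⟨ j+b≡u ⟩
        toℕ u              ≤⟨ u≤x+[1+r]x ⟩
        x + (x + r * x)    ≡⟨ +-comm x (x + r * x) ⟩
        x + r * x + x      ∎
    N[v]-blue : NbhdIn (pathAdj n) (Cum (pathAdj n) B L r) (vertex j)
    N[v]-blue w (inj₁ w≡1+v) = blue-within r (subst (_≤ x + r * x) (sym w≡1+v) 1+v≤x+rx)
    N[v]-blue w (inj₂ v≡1+w) =
      blue-within r (≤-trans (n≤1+n _) (subst (_≤ x + r * x) v≡1+w (≤-trans (n≤1+n _) 1+v≤x+rx)))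

  covered : ∀ t → n′ ≤ x * suc t → Covers (pathAdj n) B L t
  covered t n′≤x[1+t] u =
    blue-within t (≤-trans (toℕ≤pred[n] u) (subst (n′ ≤_) (*-comm x (suc t)) n′≤x[1+t]))

  ∣B∣≡b : ∣ B ∣ ≡ b
  ∣B∣≡b = ∣prefix∣≡ b≤n

Achieves : ∀ {n} → Adjacency n → ℕ → Set
Achieves {n} G k = Σ (Subset n) λ B → Σ (List (Force n)) λ L → Σ ℕ λ t →
                   ChronListOf G B L × Covers G B L t × (∣ B ∣ + t ≡ k)

path-achieves : ∀ {n x t} → 1 ≤ x → suc x ≤ n → n ∸ 1 ≤ x * suc t → Achieves (pathAdj n) (suc x + t)
path-achieves {suc n′} {x} {t} 1≤x b≤n n′≤x[1+t] =
  B , L , t , chronL , covered t n′≤x[1+t] , cong (_+ t) ∣B∣≡b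
  where open ShiftStrategy n′ x 1≤x b≤n

proposition3p5 : (n : ℕ) → 2 ≤ n → (k : ℕ) → IsCeil2Sqrt (n ∸ 1) k →
    ThH (pathAdj n) k
proposition3p5 n 2≤n k ceil@(_ , least) = achieved , optimal
  where
  achieved : Achieves (pathAdj n) k
  achieved with x , t , 1≤x , b≤n , n∸1≤x[1+t] , b+t≡k ← ceil2Sqrt-halves 2≤n ceil =
    subst (Achieves (pathAdj n)) b+t≡k (path-achieves 1≤x b≤n n∸1≤x[1+t])
  optimal : ∀ B L t → ChronListOf (pathAdj n) B L → Covers (pathAdj n) B L t → k ≤ ∣ B ∣ + t
  optimal B L t chron covers =
    least (∣ B ∣ + t) (4*[n∸1]≤[b+t]² ∣ B ∣ t 2≤n (covered⇒n≤bound t covers))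
    where open HoppingLowerBound (pathAdj n) pathAdj? (pathConnected n) B L chron
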